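{- Let $G$ be a finite abelian group and let $S$ be a proper subset of $G$. If $\mathrm{Cay}^+_G(S)$ is connected, then $\kappa(\mathrm{Cay}^+_G(S))\ge\frac12|S|$.
   Context: For a subset $S$ of an abelian group $G$ (written additively), the addition Cayley graph $\mathrm{Cay}^+_G(S)$ is the undirected graph with vertex set $G$ in which $g_1,g_2$ are adjacent iff $g_1+g_2\in S$ (loops allowed). For a graph $\Gamma$ on a finite vertex set, $\kappa(\Gamma)$ is the smallest number of vertices whose removal leaves a graph that is disconnected or has only one vertex. -}

module Defs where

open import Data.Nat using (ℕ; _≡ᵇ_)
open import Data.Fin using (Fin)
open import Data.Fin.Subset using (Subset; _∈_; _∉_; ∁; ∣_∣; ⊤)
open import Data.Product using (∃; _×_)
open import Data.Sum using (_⊎_)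
open import Relation.Nullary using (¬_)
open import Relation.Binary.PropositionalEquality using (_≡_)
open import Algebra.Structures using (IsAbelianGroup)

-- A finite abelian group, presented (up to isomorphism) on the carrier Fin n,
-- with propositional equality as the group equality.
record FiniteAbelianGroup : Set₁ where
  field
    n      : ℕ
    _+_    : Fin n → Fin n → Fin n
    0#     : Fin n
    -_     : Fin n → Fin n
    isAbelianGroup : IsAbelianGroup _≡_ _+_ 0# -_
  Carrier : Set
  Carrier = Fin n

module _ (G : FiniteAbelianGroup) where
  open FiniteAbelianGroup G

  CayAdj : Subset n → Fin n → Fin n → Set
  CayAdj S g₁ g₂ = (g₁ + g₂) ∈ S

  data Reach (S : Subset n) (U : Subset n) (u : Fin n) : Fin n → Set where
    here : u ∈ U → Reach S U u u
    step : ∀ {v w} → Reach S U u v → w ∈ U → CayAdj S v w → Reach S U u w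

  InducedConnected : Subset n → Subset n → Set
  InducedConnected S U = ∀ u v → u ∈ U → v ∈ U → Reach S U u v

  CayConnected : Subset n → Set
  CayConnected S = InducedConnected S ⊤

  Separating : Subset n → Subset n → Set
  Separating S T = (¬ InducedConnected S (∁ T)) ⊎ (∣ ∁ T ∣ ≡ 1)

  IsConnectivity : Subset n → ℕ → Set
  IsConnectivity S k =
    (∃ λ T → Separating S T × ∣ T ∣ ≡ k) × (∀ T → Separating S T → k Data.Nat.≤ ∣ T ∣)

module Submission where

-- Let N(A) be the set of vertices adjacent in Cay⁺(S) to some vertex of A. If removing T disconnects
-- the graph, the component X of a vertex outside T has N(X) ⊆ X ∪ T and misses a vertex, so it suffices
-- that |N(X)| - |X| ≥ |S|/2 for every such "fragment" X. Following Hamidoune's atom method, a fragment A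
-- minimising first |N(A)| - |A| and then |A| is a coset a₀ + H: submodularity of |N| and translation
-- invariance show that A meets each of its translates either not at all or entirely. Unless S lies in
-- one coset of H, two reflections s₀ - A and s₁ - A are disjoint subsets of N(A), so 2|A| ≤ |N(A)|.
-- If S ⊆ c + H, connectivity forces H to have index 2 and the graph to be bipartite between H and
-- H + c; running the same argument inside H for S - c bounds the two halves of each side of the
-- separation, and a second coset obstruction would make H too small. If T leaves a single vertex,
-- |S| ≤ n - 1 = |T| because S is proper.

open import Defs
open import Algebra.Bundles using (AbelianGroup)
import Algebra.Properties.AbelianGroup as AbelianGroupProperties
import Algebra.Properties.CommutativeSemigroup as CommutativeSemigroupProperties
open import Level using (0ℓ)
open import Data.Bool.Base using (Bool; if_then_else_)
open import Data.Empty using (⊥-elim)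
open import Data.Nat.Tactic.RingSolver using (solve-∀)
open import Data.Fin.Base using (Fin)
import Data.Fin.Base as Fin
open import Data.Fin.Permutation using (Permutation′; permutation; _⟨$⟩ʳ_)
open import Data.Fin.Properties using (any?; ∀-cons)
open import Data.Fin.Subset
  using (Subset; _∈_; _∉_; _⊆_; _∩_; _∪_; ∁; ⊤; ⊥; ∣_∣; Nonempty; inside; outside)
open import Data.Fin.Subset.Properties
  using (_∈?_; _⊆?_; nonempty?; anySubset?; ∈⊤; x∈∁p⇒x∉p; x∉p⇒x∈∁p; x∈p∩q⁺; x∈p∩q⁻; x∈p∪q⁺; x∈p∪q⁻;
         p∩q⊆p; p∩q⊆q; Empty-unique; p⊆q⇒∣p∣≤∣q∣; p⊂q⇒∣p∣<∣q∣; x∈p⇒∣p-x∣<∣p∣; ∣⊥∣≡0; ∣⊤∣≡n; ∣∁p∣≡n∸∣p∣)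
open import Data.Nat.Base using (ℕ; zero; suc; _+_; _*_; _∸_; _≤_; _<_; z≤n)
open import Data.Nat.Properties
open import Data.Product.Base using (∃; _×_; _,_; proj₁; proj₂)
open import Data.Sum.Base using (_⊎_; inj₁; inj₂; [_,_])
import Data.Sum.Base as Sum
open import Data.Vec.Base using ([]; _∷_; lookup; tabulate)
open import Data.Vec.Properties using (lookup∘tabulate; []=⇒lookup; lookup⇒[]=)
open import Function.Base using (_∘_; id)
open import Relation.Binary.PropositionalEquality
  using (_≡_; refl; sym; trans; cong; cong₂; subst; module ≡-Reasoning)
open import Relation.Nullary using (¬_; yes; no; does; _×-dec_; ¬?)
open import Relation.Nullary.Decidable using (dec-true; map′; decidable-stable; ¬¬-excluded-middle)
open import Relation.Unary using (Pred; Decidable)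
import Algebra.Properties.CommutativeMonoid.Sum as CommutativeMonoidSum

open CommutativeMonoidSum +-0-commutativeMonoid using (sum; sum-permute; sum-cong-≗)
open CommutativeSemigroupProperties +-commutativeSemigroup
  using () renaming (interchange to +-interchange; x∙yz≈y∙xz to m+[n+o]≡n+[m+o]; xy∙z≈xz∙y to [m+n]+o≡[m+o]+n)

∣p∩q∣+∣p∪q∣≡∣p∣+∣q∣ : ∀ {m} (p q : Subset m) → ∣ p ∩ q ∣ + ∣ p ∪ q ∣ ≡ ∣ p ∣ + ∣ q ∣
∣p∩q∣+∣p∪q∣≡∣p∣+∣q∣ []            []            = refl
∣p∩q∣+∣p∪q∣≡∣p∣+∣q∣ (outside ∷ p) (outside ∷ q) = ∣p∩q∣+∣p∪q∣≡∣p∣+∣q∣ p q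
∣p∩q∣+∣p∪q∣≡∣p∣+∣q∣ (inside ∷ p)  (inside ∷ q)  = begin
  suc ∣ p ∩ q ∣ + suc ∣ p ∪ q ∣     ≡⟨ cong suc (+-suc ∣ p ∩ q ∣ ∣ p ∪ q ∣) ⟩
  suc (suc (∣ p ∩ q ∣ + ∣ p ∪ q ∣)) ≡⟨ cong (suc ∘ suc) (∣p∩q∣+∣p∪q∣≡∣p∣+∣q∣ p q) ⟩
  suc (suc (∣ p ∣ + ∣ q ∣))         ≡⟨ cong suc (+-suc ∣ p ∣ ∣ q ∣) ⟨
  suc ∣ p ∣ + suc ∣ q ∣             ∎
  where open ≡-Reasoning
∣p∩q∣+∣p∪q∣≡∣p∣+∣q∣ (outside ∷ p) (inside ∷ q)  = trans (+-suc ∣ p ∩ q ∣ ∣ p ∪ q ∣)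
  (trans (cong suc (∣p∩q∣+∣p∪q∣≡∣p∣+∣q∣ p q)) (sym (+-suc ∣ p ∣ ∣ q ∣)))
∣p∩q∣+∣p∪q∣≡∣p∣+∣q∣ (inside ∷ p)  (outside ∷ q) =
  trans (+-suc ∣ p ∩ q ∣ ∣ p ∪ q ∣) (cong suc (∣p∩q∣+∣p∪q∣≡∣p∣+∣q∣ p q))

¬¬-∀ : ∀ {m ℓ} {P : Pred (Fin m) ℓ} → (∀ i → ¬ ¬ P i) → ¬ ¬ (∀ i → P i)
¬¬-∀ {zero}  _   ¬∀P = ¬∀P λ ()
¬¬-∀ {suc m} ¬¬P ¬∀P = ¬¬P Fin.zero λ P₀ → ¬¬-∀ (¬¬P ∘ Fin.suc) (¬∀P ∘ ∀-cons P₀)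


private
  indicator : Bool → ℕ
  indicator b = if b then 1 else 0

  ∣p∣≡sum : ∀ {m} (p : Subset m) → ∣ p ∣ ≡ sum (indicator ∘ lookup p)
  ∣p∣≡sum []            = refl
  ∣p∣≡sum (inside ∷ p)  = cong suc (∣p∣≡sum p)
  ∣p∣≡sum (outside ∷ p) = ∣p∣≡sum p

module _ {n : ℕ} where

  setOf : ∀ {ℓ} {P : Pred (Fin n) ℓ} → Decidable P → Subset n
  setOf P? = tabulate (does ∘ P?)

  module _ {ℓ} {P : Pred (Fin n) ℓ} (P? : Decidable P) where

    ∈setOf⁺ : ∀ {x} → P x → x ∈ setOf P?
    ∈setOf⁺ {x} px = lookup⇒[]= x _ (trans (lookup∘tabulate _ x) (dec-true (P? x) px))

    ∈setOf⁻ : ∀ {x} → x ∈ setOf P? → P x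
    ∈setOf⁻ {x} x∈ with P? x | trans (sym (lookup∘tabulate (does ∘ P?) x)) ([]=⇒lookup x∈)
    ... | yes px | _ = px
    ... | no  _  | ()

  private
    _⁻¹[_] : Permutation′ n → Subset n → Subset n
    π ⁻¹[ p ] = tabulate (lookup p ∘ (π ⟨$⟩ʳ_))

    ∣π⁻¹[p]∣≡∣p∣ : ∀ π p → ∣ π ⁻¹[ p ] ∣ ≡ ∣ p ∣
    ∣π⁻¹[p]∣≡∣p∣ π p = begin
      ∣ π ⁻¹[ p ] ∣                            ≡⟨ ∣p∣≡sum (π ⁻¹[ p ]) ⟩
      sum (indicator ∘ lookup (π ⁻¹[ p ]))     ≡⟨ sum-cong-≗ (cong indicator ∘ lookup∘tabulate (lookup p ∘ π⟨$⟩_)) ⟩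
      sum (indicator ∘ lookup p ∘ π⟨$⟩_)       ≡⟨ sum-permute (indicator ∘ lookup p) π ⟨
      sum (indicator ∘ lookup p)               ≡⟨ ∣p∣≡sum p ⟨
      ∣ p ∣                                    ∎
      where
      open ≡-Reasoning
      π⟨$⟩_ = π ⟨$⟩ʳ_

  π[p]⊆q⇒∣p∣≤∣q∣ : ∀ {p q : Subset n} (π : Permutation′ n) → (∀ {x} → x ∈ p → π ⟨$⟩ʳ x ∈ q) → ∣ p ∣ ≤ ∣ q ∣
  π[p]⊆q⇒∣p∣≤∣q∣ {p} {q} π π[p]⊆q = ≤-trans (p⊆q⇒∣p∣≤∣q∣ p⊆π⁻¹[q]) (≤-reflexive (∣π⁻¹[p]∣≡∣p∣ π q))
    where
    p⊆π⁻¹[q] : p ⊆ π ⁻¹[ q ]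
    p⊆π⁻¹[q] {x} x∈p = lookup⇒[]= x _ (trans (lookup∘tabulate _ x) ([]=⇒lookup (π[p]⊆q x∈p)))

  ∣p∪q∣≤∣p∣+∣q∣ : (p q : Subset n) → ∣ p ∪ q ∣ ≤ ∣ p ∣ + ∣ q ∣
  ∣p∪q∣≤∣p∣+∣q∣ p q = ≤-trans (m≤n+m ∣ p ∪ q ∣ ∣ p ∩ q ∣) (≤-reflexive (∣p∩q∣+∣p∪q∣≡∣p∣+∣q∣ p q))

  r⊆p∪q⇒∣r∣≤∣p∣+∣q∣ : ∀ {p q r : Subset n} → r ⊆ p ∪ q → ∣ r ∣ ≤ ∣ p ∣ + ∣ q ∣
  r⊆p∪q⇒∣r∣≤∣p∣+∣q∣ {p} {q} r⊆p∪q = ≤-trans (p⊆q⇒∣p∣≤∣q∣ r⊆p∪q) (∣p∪q∣≤∣p∣+∣q∣ p q)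

  disjoint⇒∣p∣+∣q∣≤∣r∣ : ∀ {p q r : Subset n} → (∀ {x} → x ∈ p → x ∉ q) → p ⊆ r → q ⊆ r → ∣ p ∣ + ∣ q ∣ ≤ ∣ r ∣
  disjoint⇒∣p∣+∣q∣≤∣r∣ {p} {q} {r} disjoint p⊆r q⊆r = begin
    ∣ p ∣ + ∣ q ∣             ≡⟨ ∣p∩q∣+∣p∪q∣≡∣p∣+∣q∣ p q ⟨
    ∣ p ∩ q ∣ + ∣ p ∪ q ∣     ≤⟨ +-mono-≤ (p⊆q⇒∣p∣≤∣q∣ p∩q⊆⊥) (p⊆q⇒∣p∣≤∣q∣ p∪q⊆r) ⟩
    ∣ ⊥ {n = n} ∣ + ∣ r ∣     ≡⟨ cong (_+ ∣ r ∣) (∣⊥∣≡0 n) ⟩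
    ∣ r ∣                     ∎
    where
    open ≤-Reasoning
    p∩q⊆⊥ : p ∩ q ⊆ ⊥
    p∩q⊆⊥ x∈p∩q = let x∈p , x∈q = x∈p∩q⁻ p q x∈p∩q in ⊥-elim (disjoint x∈p x∈q)
    p∪q⊆r : p ∪ q ⊆ r
    p∪q⊆r x∈p∪q = [ p⊆r , q⊆r ] (x∈p∪q⁻ p q x∈p∪q)

  p⊆q∧∣q∣≤∣p∣⇒q⊆p : ∀ {p q : Subset n} → p ⊆ q → ∣ q ∣ ≤ ∣ p ∣ → q ⊆ p
  p⊆q∧∣q∣≤∣p∣⇒q⊆p {p} p⊆q ∣q∣≤∣p∣ {x} x∈q with x ∈? p
  ... | yes x∈p = x∈p
  ... | no  x∉p = ⊥-elim (<⇒≱ (p⊂q⇒∣p∣<∣q∣ (p⊆q , x , x∈q , x∉p)) ∣q∣≤∣p∣)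

  x∈p⇒∣p∣>0 : ∀ {p : Subset n} {x} → x ∈ p → 0 < ∣ p ∣
  x∈p⇒∣p∣>0 x∈p = ≤-<-trans z≤n (x∈p⇒∣p-x∣<∣p∣ x∈p)

  ∃-minimal : ∀ {ℓ} {P : Pred (Subset n) ℓ} (f : Subset n → ℕ) → Decidable P →
              ∀ {p} → P p → ∃ λ q → P q × (∀ {r} → P r → f q ≤ f r)
  ∃-minimal {P = P} f P? {p} Pp = descend (f p) p ≤-refl Pp
    where
    descend : ∀ bound q → f q ≤ bound → P q → ∃ λ q → P q × (∀ {r} → P r → f q ≤ f r)
    descend bound q fq≤bound Pq with anySubset? (λ r → P? r ×-dec f r <? f q)
    ... | no ∄smaller = q , Pq , λ {r} Pr → ≮⇒≥ (λ fr<fq → ∄smaller (r , Pr , fr<fq))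
    ... | yes (r , Pr , fr<fq) with bound
    ...   | zero      = ⊥-elim (n≮0 (≤-trans fr<fq fq≤bound))
    ...   | suc bound = descend bound r (≤-pred (≤-trans fr<fq fq≤bound)) Pr

module GroupLemmas (G : FiniteAbelianGroup) where

  open FiniteAbelianGroup G renaming (_+_ to infixl 6 _⊕_; -_ to infix 8 ⊖_; 0# to 𝟎)

  abelianGroup : AbelianGroup 0ℓ 0ℓ
  abelianGroup = record { isAbelianGroup = isAbelianGroup }

  open AbelianGroup abelianGroup public using (assoc; comm; identityʳ) renaming (_-_ to infixl 6 _⊖_)
  open AbelianGroup abelianGroup using (inverseʳ)
  open AbelianGroupProperties abelianGroup
    using (//-rightDividesˡ; //-rightDividesʳ; \\-leftDividesʳ; ⁻¹-anti-homo‿-; ⁻¹-∙-comm)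
  open CommutativeSemigroupProperties (AbelianGroup.commutativeSemigroup abelianGroup)
    using (interchange; xy∙z≈xz∙y)
  open ≡-Reasoning

  [x-y]+y≡x : ∀ x y → (x ⊖ y) ⊕ y ≡ x
  [x-y]+y≡x x y = //-rightDividesˡ y x

  [x+y]-y≡x : ∀ x y → (x ⊕ y) ⊖ y ≡ x
  [x+y]-y≡x x y = //-rightDividesʳ y x

  x+[y-x]≡y : ∀ x y → x ⊕ (y ⊖ x) ≡ y
  x+[y-x]≡y x y = trans (comm x (y ⊖ x)) ([x-y]+y≡x y x)

  [x+y]-x≡y : ∀ x y → (x ⊕ y) ⊖ x ≡ y
  [x+y]-x≡y x y = trans (cong (_⊖ x) (comm x y)) ([x+y]-y≡x y x)

  x-[x-y]≡y : ∀ x y → x ⊖ (x ⊖ y) ≡ y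
  x-[x-y]≡y x y = trans (cong (x ⊕_) (⁻¹-anti-homo‿- x y)) (x+[y-x]≡y x y)

  [x-z]-[y-z]≡x-y : ∀ x y z → (x ⊖ z) ⊖ (y ⊖ z) ≡ x ⊖ y
  [x-z]-[y-z]≡x-y x y z = begin
    (x ⊖ z) ⊖ (y ⊖ z)     ≡⟨ cong ((x ⊖ z) ⊕_) (⁻¹-anti-homo‿- y z) ⟩
    (x ⊖ z) ⊕ (z ⊖ y)     ≡⟨ assoc x (⊖ z) (z ⊖ y) ⟩
    x ⊕ (⊖ z ⊕ (z ⊖ y))   ≡⟨ cong (x ⊕_) (\\-leftDividesʳ z (⊖ y)) ⟩
    x ⊖ y                 ∎

  [x+y]+[z-y]≡x+z : ∀ x y z → (x ⊕ y) ⊕ (z ⊖ y) ≡ x ⊕ z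
  [x+y]+[z-y]≡x+z x y z = begin
    (x ⊕ y) ⊕ (z ⊖ y)     ≡⟨ interchange x y z (⊖ y) ⟩
    (x ⊕ z) ⊕ (y ⊖ y)     ≡⟨ cong ((x ⊕ z) ⊕_) (inverseʳ y) ⟩
    (x ⊕ z) ⊕ 𝟎           ≡⟨ identityʳ (x ⊕ z) ⟩
    x ⊕ z                 ∎

  [x-y]-z≡x-[y+z] : ∀ x y z → (x ⊖ y) ⊖ z ≡ x ⊖ (y ⊕ z)
  [x-y]-z≡x-[y+z] x y z = trans (assoc x (⊖ y) (⊖ z)) (cong (x ⊕_) (⁻¹-∙-comm y z))

  [x+y]+z≡[x+z]+y : ∀ x y z → (x ⊕ y) ⊕ z ≡ (x ⊕ z) ⊕ y
  [x+y]+z≡[x+z]+y = xy∙z≈xz∙y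

  translation : Carrier → Permutation′ n
  translation g = permutation (_⊕ g) (_⊖ g) (λ y → [x-y]+y≡x y g) (λ x → [x+y]-y≡x x g)

  reflection : Carrier → Permutation′ n
  reflection s = permutation (λ x → s ⊖ x) (λ x → s ⊖ x) (x-[x-y]≡y s) (x-[x-y]≡y s)

module _ (G : FiniteAbelianGroup) where

  open FiniteAbelianGroup G renaming (_+_ to infixl 6 _⊕_; -_ to infix 8 ⊖_; 0# to 𝟎)
  open GroupLemmas G

  record IsSubgroup (H : Subset n) : Set where
    field
      𝟎∈       : 𝟎 ∈ H
      ⊕-closed : ∀ {x y} → x ∈ H → y ∈ H → x ⊕ y ∈ H
      ⊖‿closed : ∀ {x} → x ∈ H → ⊖ x ∈ H

    ⊖-closed : ∀ {x y} → x ∈ H → y ∈ H → x ⊖ y ∈ H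
    ⊖-closed x∈H y∈H = ⊕-closed x∈H (⊖‿closed y∈H)

  ⊤-isSubgroup : IsSubgroup ⊤
  ⊤-isSubgroup = record { 𝟎∈ = ∈⊤ ; ⊕-closed = λ _ _ → ∈⊤ ; ⊖‿closed = λ _ → ∈⊤ }

  proper⇒2∣H∣≤∣K∣ : ∀ {H K g} → IsSubgroup H → IsSubgroup K → H ⊆ K → g ∈ K → g ∉ H → 2 * ∣ H ∣ ≤ ∣ K ∣
  proper⇒2∣H∣≤∣K∣ {H} {K} {g} H-subgroup K-subgroup H⊆K g∈K g∉H = begin
    2 * ∣ H ∣            ≡⟨ cong (∣ H ∣ +_) (+-identityʳ ∣ H ∣) ⟩
    ∣ H ∣ + ∣ H ∣        ≤⟨ +-monoʳ-≤ ∣ H ∣ (π[p]⊆q⇒∣p∣≤∣q∣ (translation g) λ {x} x∈H →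
                              ∈setOf⁺ H⊕g? (subst (_∈ H) (sym ([x+y]-y≡x x g)) x∈H)) ⟩
    ∣ H ∣ + ∣ H⊕g ∣      ≤⟨ disjoint⇒∣p∣+∣q∣≤∣r∣ disjoint H⊆K H⊕g⊆K ⟩
    ∣ K ∣                ∎
    where
    open ≤-Reasoning
    open IsSubgroup H-subgroup
    H⊕g? : Decidable (λ x → x ⊖ g ∈ H)
    H⊕g? x = (x ⊖ g) ∈? H
    H⊕g : Subset n
    H⊕g = setOf H⊕g?
    disjoint : ∀ {x} → x ∈ H → x ∉ H⊕g
    disjoint {x} x∈H x∈H⊕g = g∉H (subst (_∈ H) (x-[x-y]≡y x g) (⊖-closed x∈H (∈setOf⁻ H⊕g? x∈H⊕g)))
    H⊕g⊆K : H⊕g ⊆ K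
    H⊕g⊆K {x} x∈H⊕g = subst (_∈ K) ([x-y]+y≡x x g)
      (IsSubgroup.⊕-closed K-subgroup (H⊆K (∈setOf⁻ H⊕g? x∈H⊕g)) g∈K)

  module Isoperimetry {K S : Subset n} (K-subgroup : IsSubgroup K) (S⊆K : S ⊆ K) {s₀} (s₀∈S : s₀ ∈ S) where

    open IsSubgroup K-subgroup

    adjacent? : ∀ A → Decidable (λ z → ∃ λ a → a ∈ A × a ⊕ z ∈ S)
    adjacent? A z = any? (λ a → a ∈? A ×-dec (a ⊕ z) ∈? S)

    N : Subset n → Subset n
    N A = setOf (adjacent? A)

    ∈N⁺ : ∀ {A a z} → a ∈ A → a ⊕ z ∈ S → z ∈ N A
    ∈N⁺ {A} a∈A a⊕z∈S = ∈setOf⁺ (adjacent? A) (_ , a∈A , a⊕z∈S)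

    ∈N⁻ : ∀ {A z} → z ∈ N A → ∃ λ a → a ∈ A × a ⊕ z ∈ S
    ∈N⁻ {A} = ∈setOf⁻ (adjacent? A)

    N-mono : ∀ {A B} → A ⊆ B → N A ⊆ N B
    N-mono A⊆B z∈NA = let _ , a∈A , a⊕z∈S = ∈N⁻ z∈NA in ∈N⁺ (A⊆B a∈A) a⊕z∈S

    N⊆K : ∀ {A} → A ⊆ K → N A ⊆ K
    N⊆K A⊆K {z} z∈NA = let a , a∈A , a⊕z∈S = ∈N⁻ z∈NA in
      subst (_∈ K) ([x+y]-x≡y a z) (⊖-closed (S⊆K a⊕z∈S) (A⊆K a∈A))

    ∣A∣≤∣NA∣ : ∀ A → ∣ A ∣ ≤ ∣ N A ∣
    ∣A∣≤∣NA∣ A = π[p]⊆q⇒∣p∣≤∣q∣ (reflection s₀) λ {z} z∈A →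
      ∈N⁺ z∈A (subst (_∈ S) (sym (x+[y-x]≡y z s₀)) s₀∈S)

    ∣S∣≤∣NA∣ : ∀ {A a} → a ∈ A → ∣ S ∣ ≤ ∣ N A ∣
    ∣S∣≤∣NA∣ {a = a} a∈A = π[p]⊆q⇒∣p∣≤∣q∣ (translation (⊖ a)) λ {s} s∈S →
      ∈N⁺ a∈A (subst (_∈ S) (sym (x+[y-x]≡y a s)) s∈S)

    -- The subtraction never truncates, see excess+∣A∣≡∣NA∣.
    excess : Subset n → ℕ
    excess A = ∣ N A ∣ ∸ ∣ A ∣

    excess+∣A∣≡∣NA∣ : ∀ A → excess A + ∣ A ∣ ≡ ∣ N A ∣
    excess+∣A∣≡∣NA∣ A = m∸n+n≡m (∣A∣≤∣NA∣ A)

    unreached? : ∀ A → Decidable (λ z → z ∈ K × z ∉ N A)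
    unreached? A z = z ∈? K ×-dec ¬? (z ∈? N A)

    dual : Subset n → Subset n
    dual A = setOf (unreached? A)

    ∈dual⁺ : ∀ {A z} → z ∈ K → z ∉ N A → z ∈ dual A
    ∈dual⁺ {A} z∈K z∉NA = ∈setOf⁺ (unreached? A) (z∈K , z∉NA)

    ∈dual⁻ : ∀ {A z} → z ∈ dual A → z ∈ K × z ∉ N A
    ∈dual⁻ {A} = ∈setOf⁻ (unreached? A)

    record Fragment (A : Subset n) : Set where
      field
        ⊆K       : A ⊆ K
        nonempty : Nonempty A
        missing  : ∃ λ z → z ∈ K × z ∉ N A

    fragment? : Decidable Fragment
    fragment? A = map′ toFragment fromFragment
      (A ⊆? K ×-dec nonempty? A ×-dec any? (unreached? A))
      where
      Fragment′ = A ⊆ K × Nonempty A × ∃ λ z → z ∈ K × z ∉ N A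
      toFragment : Fragment′ → Fragment A
      toFragment (A⊆K , A≢∅ , z) = record { ⊆K = A⊆K ; nonempty = A≢∅ ; missing = z }
      fromFragment : Fragment A → Fragment′
      fromFragment F = let open Fragment F in ⊆K , nonempty , missing

    record IsAtom (A : Subset n) : Set where
      field
        fragment       : Fragment A
        excess-minimal : ∀ {B} → Fragment B → excess A ≤ excess B
        size-minimal   : ∀ {B} → Fragment B → excess B ≤ excess A → ∣ A ∣ ≤ ∣ B ∣

    atom : ∀ {B} → Fragment B → ∃ IsAtom
    atom F₀ with ∃-minimal excess fragment? F₀
    ... | A₁ , F₁ , min₁ with ∃-minimal ∣_∣ (λ B → fragment? B ×-dec excess B ≤? excess A₁) (F₁ , ≤-refl)
    ... | A , (F , eA≤eA₁) , min = A , record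
      { fragment       = F
      ; excess-minimal = λ F′ → ≤-trans eA≤eA₁ (min₁ F′)
      ; size-minimal   = λ F′ e≤eA → min (F′ , ≤-trans e≤eA eA≤eA₁)
      }


    N[dual]∩A≡∅ : ∀ {A x} → x ∈ N (dual A) → x ∉ A
    N[dual]∩A≡∅ x∈N[A⋆] x∈A = let b , b∈A⋆ , b⊕x∈S = ∈N⁻ x∈N[A⋆] in
      proj₂ (∈dual⁻ b∈A⋆) (∈N⁺ x∈A (subst (_∈ S) (comm b _) b⊕x∈S))

    dual-fragment : ∀ {A} → Fragment A → Fragment (dual A)
    dual-fragment F = record
      { ⊆K       = proj₁ ∘ ∈dual⁻
      ; nonempty = let z , z∈K , z∉NA = missing in z , ∈dual⁺ z∈K z∉NA
      ; missing  = let a , a∈A = nonempty in a , ⊆K a∈A , λ a∈N[A⋆] → N[dual]∩A≡∅ a∈N[A⋆] a∈A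
      }
      where open Fragment F

    ∣dual∣+∣N∣≡∣K∣ : ∀ {A} → A ⊆ K → ∣ dual A ∣ + ∣ N A ∣ ≡ ∣ K ∣
    ∣dual∣+∣N∣≡∣K∣ {A} A⊆K = ≤-antisym
      (disjoint⇒∣p∣+∣q∣≤∣r∣ (proj₂ ∘ ∈dual⁻) (proj₁ ∘ ∈dual⁻) (N⊆K A⊆K))
      (r⊆p∪q⇒∣r∣≤∣p∣+∣q∣ K⊆A⋆∪NA)
      where
      K⊆A⋆∪NA : K ⊆ dual A ∪ N A
      K⊆A⋆∪NA {z} z∈K with z ∈? N A
      ... | yes z∈NA = x∈p∪q⁺ (inj₂ z∈NA)
      ... | no  z∉NA = x∈p∪q⁺ (inj₁ (∈dual⁺ z∈K z∉NA))

    record CosetObstruction : Set where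
      field
        H          : Subset n
        H-subgroup : IsSubgroup H
        H⊆K        : H ⊆ K
        g          : Fin n
        g∈K        : g ∈ K
        g∉H        : g ∉ H
        c          : Fin n
        S⊆c⊕H      : ∀ {s} → s ∈ S → s ⊖ c ∈ H

    module Atom {A} (A-atom : IsAtom A) where

      open IsAtom A-atom
      open Fragment fragment renaming (⊆K to A⊆K)

      atom-size : ∣ A ∣ + ∣ N A ∣ ≤ ∣ K ∣
      atom-size = begin
        ∣ A ∣ + ∣ N A ∣        ≤⟨ +-monoˡ-≤ (∣ N A ∣) (size-minimal (dual-fragment fragment) excess-A⋆≤excess-A) ⟩
        ∣ dual A ∣ + ∣ N A ∣   ≡⟨ ∣dual∣+∣N∣≡∣K∣ A⊆K ⟩
        ∣ K ∣                  ∎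
        where
        open ≤-Reasoning
        A⋆ = dual A
        excess-A⋆≤excess-A : excess A⋆ ≤ excess A
        excess-A⋆≤excess-A = +-cancelʳ-≤ (∣ A⋆ ∣ + ∣ A ∣) (excess A⋆) (excess A) (begin
          excess A⋆ + (∣ A⋆ ∣ + ∣ A ∣)  ≡⟨ +-assoc (excess A⋆) (∣ A⋆ ∣) (∣ A ∣) ⟨
          excess A⋆ + ∣ A⋆ ∣ + ∣ A ∣    ≡⟨ cong (_+ ∣ A ∣) (excess+∣A∣≡∣NA∣ A⋆) ⟩
          ∣ N A⋆ ∣ + ∣ A ∣              ≤⟨ disjoint⇒∣p∣+∣q∣≤∣r∣ N[dual]∩A≡∅ (N⊆K (proj₁ ∘ ∈dual⁻)) A⊆K ⟩
          ∣ K ∣                         ≡⟨ ∣dual∣+∣N∣≡∣K∣ A⊆K ⟨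
          ∣ A⋆ ∣ + ∣ N A ∣              ≡⟨ cong (∣ A⋆ ∣ +_) (excess+∣A∣≡∣NA∣ A) ⟨
          ∣ A⋆ ∣ + (excess A + ∣ A ∣)   ≡⟨ m+[n+o]≡n+[m+o] (∣ A⋆ ∣) (excess A) (∣ A ∣) ⟩
          excess A + (∣ A⋆ ∣ + ∣ A ∣)   ∎)

      -- With A′ = A ⊖ g, I = A ∩ A′ and U = A ∪ A′ submodularity gives |N I| + |N U| ≤ 2|N A|. U is a
      -- fragment (N U = K would contradict atom-size), so I has excess at most that of A, and
      -- minimality of |A| forces I = A.
      module _ {g x} (g∈K : g ∈ K) (x∈A : x ∈ A) (x⊕g∈A : x ⊕ g ∈ A) where

        private
          A′? : Decidable (λ z → z ⊕ g ∈ A)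
          A′? z = (z ⊕ g) ∈? A

          A′ I U : Subset n
          A′ = setOf A′?
          I  = A ∩ A′
          U  = A ∪ A′

          A′⊆K : A′ ⊆ K
          A′⊆K {z} z∈A′ = subst (_∈ K) ([x+y]-y≡x z g) (⊖-closed (A⊆K (∈setOf⁻ A′? z∈A′)) g∈K)

          ∣A∣≤∣A′∣ : ∣ A ∣ ≤ ∣ A′ ∣
          ∣A∣≤∣A′∣ = π[p]⊆q⇒∣p∣≤∣q∣ (translation (⊖ g)) λ {a} a∈A →
            ∈setOf⁺ A′? (subst (_∈ A) (sym ([x-y]+y≡x a g)) a∈A)

          ∣NA′∣≤∣NA∣ : ∣ N A′ ∣ ≤ ∣ N A ∣
          ∣NA′∣≤∣NA∣ = π[p]⊆q⇒∣p∣≤∣q∣ (translation (⊖ g)) λ {z} z∈NA′ →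
            let a′ , a′∈A′ , a′⊕z∈S = ∈N⁻ z∈NA′ in
            ∈N⁺ (∈setOf⁻ A′? a′∈A′) (subst (_∈ S) (sym ([x+y]+[z-y]≡x+z a′ g z)) a′⊕z∈S)

          ∣NI∣+∣NU∣≤∣NA∣+∣NA∣ : ∣ N I ∣ + ∣ N U ∣ ≤ ∣ N A ∣ + ∣ N A ∣
          ∣NI∣+∣NU∣≤∣NA∣+∣NA∣ = begin
            ∣ N I ∣ + ∣ N U ∣                ≤⟨ +-mono-≤ (p⊆q⇒∣p∣≤∣q∣ NI⊆NA∩NA′) (p⊆q⇒∣p∣≤∣q∣ NU⊆NA∪NA′) ⟩
            ∣ N A ∩ N A′ ∣ + ∣ N A ∪ N A′ ∣  ≡⟨ ∣p∩q∣+∣p∪q∣≡∣p∣+∣q∣ (N A) (N A′) ⟩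
            ∣ N A ∣ + ∣ N A′ ∣               ≤⟨ +-monoʳ-≤ (∣ N A ∣) ∣NA′∣≤∣NA∣ ⟩
            ∣ N A ∣ + ∣ N A ∣                ∎
            where
            open ≤-Reasoning
            NI⊆NA∩NA′ : N I ⊆ N A ∩ N A′
            NI⊆NA∩NA′ z∈NI = x∈p∩q⁺ (N-mono (p∩q⊆p A A′) z∈NI , N-mono (p∩q⊆q A A′) z∈NI)
            NU⊆NA∪NA′ : N U ⊆ N A ∪ N A′
            NU⊆NA∪NA′ z∈NU = let b , b∈U , b⊕z∈S = ∈N⁻ z∈NU in
              x∈p∪q⁺ (Sum.map (λ b∈A → ∈N⁺ b∈A b⊕z∈S) (λ b∈A′ → ∈N⁺ b∈A′ b⊕z∈S) (x∈p∪q⁻ A A′ b∈U))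

          ∣A∣+∣A∣≤∣I∣+∣U∣ : ∣ A ∣ + ∣ A ∣ ≤ ∣ I ∣ + ∣ U ∣
          ∣A∣+∣A∣≤∣I∣+∣U∣ = ≤-trans (+-monoʳ-≤ (∣ A ∣) ∣A∣≤∣A′∣) (≤-reflexive (sym (∣p∩q∣+∣p∪q∣≡∣p∣+∣q∣ A A′)))

          x∈I : x ∈ I
          x∈I = x∈p∩q⁺ (x∈A , ∈setOf⁺ A′? x⊕g∈A)

          I-fragment : Fragment I
          I-fragment = record
            { ⊆K       = A⊆K ∘ p∩q⊆p A A′
            ; nonempty = x , x∈I
            ; missing  = let z , z∈K , z∉NA = missing in z , z∈K , z∉NA ∘ N-mono (p∩q⊆p A A′)
            }

          K⊈NU : ¬ K ⊆ N U
          K⊈NU K⊆NU = <⇒≱ (x∈p⇒∣p∣>0 x∈I) (+-cancelˡ-≤ (excess A + ∣ A ∣ + ∣ N A ∣) (∣ I ∣) 0 (begin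
            excess A + ∣ A ∣ + ∣ N A ∣ + ∣ I ∣     ≡⟨ cong (_+ ∣ I ∣) (+-assoc (excess A) (∣ A ∣) (∣ N A ∣)) ⟩
            excess A + (∣ A ∣ + ∣ N A ∣) + ∣ I ∣   ≡⟨ [m+n]+o≡[m+o]+n (excess A) (∣ A ∣ + ∣ N A ∣) (∣ I ∣) ⟩
            excess A + ∣ I ∣ + (∣ A ∣ + ∣ N A ∣)   ≤⟨ +-mono-≤ (+-monoˡ-≤ (∣ I ∣) (excess-minimal I-fragment))
                                                            (≤-trans atom-size (p⊆q⇒∣p∣≤∣q∣ K⊆NU)) ⟩
            excess I + ∣ I ∣ + ∣ N U ∣             ≡⟨ cong (_+ ∣ N U ∣) (excess+∣A∣≡∣NA∣ I) ⟩
            ∣ N I ∣ + ∣ N U ∣                      ≤⟨ ∣NI∣+∣NU∣≤∣NA∣+∣NA∣ ⟩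
            ∣ N A ∣ + ∣ N A ∣                      ≡⟨ cong (_+ ∣ N A ∣) (excess+∣A∣≡∣NA∣ A) ⟨
            excess A + ∣ A ∣ + ∣ N A ∣             ≡⟨ +-identityʳ _ ⟨
            excess A + ∣ A ∣ + ∣ N A ∣ + 0         ∎))
            where open ≤-Reasoning

          U-fragment : Fragment U
          U-fragment = record
            { ⊆K       = [ A⊆K , A′⊆K ] ∘ x∈p∪q⁻ A A′
            ; nonempty = x , x∈p∪q⁺ (inj₁ x∈A)
            ; missing  = decidable-stable (any? (unreached? U)) λ ∄z →
                K⊈NU λ {z} z∈K → decidable-stable (z ∈? N U) λ z∉NU → ∄z (z , z∈K , z∉NU)
            }

          excess-I≤excess-A : excess I ≤ excess A
          excess-I≤excess-A = +-cancelʳ-≤ (excess A) (excess I) (excess A)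
            (+-cancelʳ-≤ (∣ I ∣ + ∣ U ∣) (excess I + excess A) (excess A + excess A) (begin
              excess I + excess A + (∣ I ∣ + ∣ U ∣)   ≤⟨ +-monoˡ-≤ (∣ I ∣ + ∣ U ∣)
                                                             (+-monoʳ-≤ (excess I) (excess-minimal U-fragment)) ⟩
              excess I + excess U + (∣ I ∣ + ∣ U ∣)   ≡⟨ +-interchange (excess I) (excess U) (∣ I ∣) (∣ U ∣) ⟩
              excess I + ∣ I ∣ + (excess U + ∣ U ∣)   ≡⟨ cong₂ _+_ (excess+∣A∣≡∣NA∣ I) (excess+∣A∣≡∣NA∣ U) ⟩
              ∣ N I ∣ + ∣ N U ∣                       ≤⟨ ∣NI∣+∣NU∣≤∣NA∣+∣NA∣ ⟩
              ∣ N A ∣ + ∣ N A ∣                       ≡⟨ cong₂ _+_ (excess+∣A∣≡∣NA∣ A) (excess+∣A∣≡∣NA∣ A) ⟨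
              excess A + ∣ A ∣ + (excess A + ∣ A ∣)   ≡⟨ +-interchange (excess A) (∣ A ∣) (excess A) (∣ A ∣) ⟩
              excess A + excess A + (∣ A ∣ + ∣ A ∣)   ≤⟨ +-monoʳ-≤ (excess A + excess A) ∣A∣+∣A∣≤∣I∣+∣U∣ ⟩
              excess A + excess A + (∣ I ∣ + ∣ U ∣)   ∎))
            where open ≤-Reasoning

        translate-closed : ∀ {a} → a ∈ A → a ⊕ g ∈ A
        translate-closed a∈A = ∈setOf⁻ A′? (proj₂ (x∈p∩q⁻ A A′ (A⊆I a∈A)))
          where
          A⊆I : A ⊆ I
          A⊆I = p⊆q∧∣q∣≤∣p∣⇒q⊆p (p∩q⊆p A A′) (size-minimal I-fragment excess-I≤excess-A)

      private
        a₀ : Fin n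
        a₀ = proj₁ nonempty

        a₀∈A : a₀ ∈ A
        a₀∈A = proj₂ nonempty

        period? : Decidable (λ d → a₀ ⊕ d ∈ A)
        period? d = (a₀ ⊕ d) ∈? A

      period : Subset n
      period = setOf period?

      period⊆K : period ⊆ K
      period⊆K {d} d∈P = subst (_∈ K) ([x+y]-x≡y a₀ d) (⊖-closed (A⊆K (∈setOf⁻ period? d∈P)) (A⊆K a₀∈A))

      period-translates : ∀ {d a} → d ∈ period → a ∈ A → a ⊕ d ∈ A
      period-translates d∈P = translate-closed (period⊆K d∈P) a₀∈A (∈setOf⁻ period? d∈P)

      period-isSubgroup : IsSubgroup period
      period-isSubgroup = record
        { 𝟎∈       = ∈setOf⁺ period? (subst (_∈ A) (sym (identityʳ a₀)) a₀∈A)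
        ; ⊕-closed = λ {x} {y} x∈P y∈P → ∈setOf⁺ period?
            (subst (_∈ A) (assoc a₀ x y) (period-translates y∈P (∈setOf⁻ period? x∈P)))
        ; ⊖‿closed = λ {d} d∈P → ∈setOf⁺ period?
            (translate-closed (⊖‿closed (period⊆K d∈P)) (∈setOf⁻ period? d∈P)
              (subst (_∈ A) (sym ([x+y]-y≡x a₀ d)) a₀∈A) a₀∈A)
        }

      differences∈period : ∀ {a b} → a ∈ A → b ∈ A → b ⊖ a ∈ period
      differences∈period {a} {b} a∈A b∈A = ∈setOf⁺ period?
        (translate-closed (⊖-closed (A⊆K b∈A) (A⊆K a∈A)) a∈A (subst (_∈ A) (sym (x+[y-x]≡y a b)) b∈A) a₀∈A)

      ∣A∣+∣A∣≤∣NA∣ : ∀ {s₁} → s₁ ∈ S → s₁ ⊖ s₀ ∉ period → ∣ A ∣ + ∣ A ∣ ≤ ∣ N A ∣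
      ∣A∣+∣A∣≤∣NA∣ {s₁} s₁∈S s₁⊖s₀∉P = begin
        ∣ A ∣ + ∣ A ∣                    ≤⟨ +-mono-≤ (∣A∣≤∣s⊖A∣ s₀) (∣A∣≤∣s⊖A∣ s₁) ⟩
        ∣ s₀ ⊖A ∣ + ∣ s₁ ⊖A ∣            ≤⟨ disjoint⇒∣p∣+∣q∣≤∣r∣ disjoint (s⊖A⊆NA s₀∈S) (s⊖A⊆NA s₁∈S) ⟩
        ∣ N A ∣                          ∎
        where
        open ≤-Reasoning
        _⊖A? : ∀ s → Decidable (λ z → s ⊖ z ∈ A)
        (s ⊖A?) z = (s ⊖ z) ∈? A
        _⊖A : Fin n → Subset n
        s ⊖A = setOf (s ⊖A?)
        ∣A∣≤∣s⊖A∣ : ∀ s → ∣ A ∣ ≤ ∣ s ⊖A ∣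
        ∣A∣≤∣s⊖A∣ s = π[p]⊆q⇒∣p∣≤∣q∣ (reflection s) λ {a} a∈A →
          ∈setOf⁺ (s ⊖A?) (subst (_∈ A) (sym (x-[x-y]≡y s a)) a∈A)
        s⊖A⊆NA : ∀ {s} → s ∈ S → s ⊖A ⊆ N A
        s⊖A⊆NA {s} s∈S {z} z∈s⊖A = ∈N⁺ (∈setOf⁻ (s ⊖A?) z∈s⊖A) (subst (_∈ S) (sym ([x-y]+y≡x s z)) s∈S)
        disjoint : ∀ {z} → z ∈ s₀ ⊖A → z ∉ s₁ ⊖A
        disjoint {z} z∈s₀⊖A z∈s₁⊖A = s₁⊖s₀∉P (subst (_∈ period) ([x-z]-[y-z]≡x-y s₁ s₀ z)
          (differences∈period (∈setOf⁻ (s₀ ⊖A?) z∈s₀⊖A) (∈setOf⁻ (s₁ ⊖A?) z∈s₁⊖A)))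

      isoperimetric : ∀ {s₁} → s₁ ∈ S → s₁ ⊖ s₀ ∉ period → ∀ {B} → Fragment B → ∣ S ∣ ≤ 2 * excess B
      isoperimetric s₁∈S s₁⊖s₀∉P {B} F = begin
        ∣ S ∣                  ≤⟨ ∣S∣≤∣NA∣ a₀∈A ⟩
        ∣ N A ∣                ≡⟨ excess+∣A∣≡∣NA∣ A ⟨
        excess A + ∣ A ∣       ≤⟨ +-monoʳ-≤ (excess A) ∣A∣≤excess-A ⟩
        excess A + excess A    ≤⟨ +-mono-≤ (excess-minimal F) (excess-minimal F) ⟩
        excess B + excess B    ≡⟨ cong (excess B +_) (+-identityʳ (excess B)) ⟨
        2 * excess B           ∎
        where
        open ≤-Reasoning
        ∣A∣≤excess-A : ∣ A ∣ ≤ excess A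
        ∣A∣≤excess-A = +-cancelʳ-≤ (∣ A ∣) (∣ A ∣) (excess A)
          (≤-trans (∣A∣+∣A∣≤∣NA∣ s₁∈S s₁⊖s₀∉P) (≤-reflexive (sym (excess+∣A∣≡∣NA∣ A))))

      atom-dichotomy : (∀ {B} → Fragment B → ∣ S ∣ ≤ 2 * excess B) ⊎ CosetObstruction
      atom-dichotomy with any? (λ s → s ∈? S ×-dec ¬? ((s ⊖ s₀) ∈? period))
      ... | yes (s₁ , s₁∈S , s₁⊖s₀∉P) = inj₁ (isoperimetric s₁∈S s₁⊖s₀∉P)
      ... | no  ∄s = inj₂ record
        { H          = period
        ; H-subgroup = period-isSubgroup
        ; H⊆K        = period⊆K
        ; g          = g
        ; g∈K        = ⊖-closed (⊖-closed (S⊆K s₀∈S) z₀∈K) (A⊆K a₀∈A)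
        ; g∉H        = g∉period
        ; c          = s₀
        ; S⊆c⊕H      = λ {s} s∈S → decidable-stable ((s ⊖ s₀) ∈? period) (λ s⊖s₀∉P → ∄s (s , s∈S , s⊖s₀∉P))
        }
        where
        z₀ = proj₁ missing
        z₀∈K = proj₁ (proj₂ missing)
        g = (s₀ ⊖ z₀) ⊖ a₀
        g∉period : g ∉ period
        g∉period g∈P = proj₂ (proj₂ missing) (∈N⁺ (subst (_∈ A) (x+[y-x]≡y a₀ (s₀ ⊖ z₀)) (∈setOf⁻ period? g∈P))
          (subst (_∈ S) (sym ([x-y]+y≡x s₀ z₀)) s₀∈S))

    isoperimetric-or-coset : (∀ {B} → Fragment B → ∣ S ∣ ≤ 2 * excess B) ⊎ CosetObstruction
    isoperimetric-or-coset with anySubset? fragment?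
    ... | no  ∄F      = inj₁ λ F → ⊥-elim (∄F (_ , F))
    ... | yes (_ , F) = Atom.atom-dichotomy (proj₂ (atom F))

  Closed : Subset n → Subset n → Subset n → Set
  Closed S T Z = ∀ {x w} → x ∈ Z → w ∉ T → CayAdj G S x w → w ∈ Z

  closed-step : ∀ {S T Z x w} → Closed S T Z → x ∈ Z → CayAdj G S x w → w ∈ Z ⊎ w ∈ T
  closed-step {T = T} {w = w} Z-closed x∈Z x~w with w ∈? T
  ... | yes w∈T = inj₂ w∈T
  ... | no  w∉T = inj₁ (Z-closed x∈Z w∉T x~w)

  module Connected {S : Subset n} (connected : CayConnected G S) where

    coset-cover : ∀ {H c} → IsSubgroup H → (∀ {s} → s ∈ S → s ⊖ c ∈ H) → ∀ w → w ∈ H ⊎ w ⊖ c ∈ H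
    coset-cover {H} {c} H-subgroup S⊆c⊕H w = walk (connected 𝟎 w ∈⊤ ∈⊤)
      where
      open IsSubgroup H-subgroup
      walk : ∀ {w} → Reach G S ⊤ 𝟎 w → w ∈ H ⊎ w ⊖ c ∈ H
      walk (here _) = inj₁ 𝟎∈
      walk (step {v} {w} path _ v⊕w∈S) with walk path
      ... | inj₁ v∈H   = inj₂ (subst (_∈ H) (trans (cong (_⊖ v) (assoc v w (⊖ c))) ([x+y]-x≡y v (w ⊖ c)))
                                  (⊖-closed (S⊆c⊕H v⊕w∈S) v∈H))
      ... | inj₂ v⊖c∈H = inj₁ (subst (_∈ H) (trans ([x-z]-[y-z]≡x-y (v ⊕ w) v c) ([x+y]-x≡y v w))
                                  (⊖-closed (S⊆c⊕H v⊕w∈S) v⊖c∈H))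

    n≤2∣H∣ : ∀ {H c} → IsSubgroup H → (∀ {s} → s ∈ S → s ⊖ c ∈ H) → n ≤ 2 * ∣ H ∣
    n≤2∣H∣ {H} {c} H-subgroup S⊆c⊕H = begin
      n                   ≡⟨ ∣⊤∣≡n n ⟨
      ∣ ⊤ {n = n} ∣       ≤⟨ r⊆p∪q⇒∣r∣≤∣p∣+∣q∣ {r = ⊤} (λ {w} _ →
                               x∈p∪q⁺ (Sum.map₂ (∈setOf⁺ H⊕c?) (coset-cover H-subgroup S⊆c⊕H w))) ⟩
      ∣ H ∣ + ∣ H⊕c ∣     ≤⟨ +-monoʳ-≤ (∣ H ∣) (π[p]⊆q⇒∣p∣≤∣q∣ (translation (⊖ c)) (∈setOf⁻ H⊕c?)) ⟩
      ∣ H ∣ + ∣ H ∣       ≡⟨ cong (∣ H ∣ +_) (+-identityʳ (∣ H ∣)) ⟨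
      2 * ∣ H ∣           ∎
      where
      open ≤-Reasoning
      H⊕c? : Decidable (λ w → w ⊖ c ∈ H)
      H⊕c? w = (w ⊖ c) ∈? H
      H⊕c = setOf H⊕c?

    module Bipartite {s₀ H g c} (s₀∈S : s₀ ∈ S) (H-subgroup : IsSubgroup H) (g∉H : g ∉ H)
                     (S⊆c⊕H : ∀ {s} → s ∈ S → s ⊖ c ∈ H) where

      open IsSubgroup H-subgroup

      private
        S′? : Decidable (λ z → z ⊕ c ∈ S)
        S′? z = (z ⊕ c) ∈? S

        S′ : Subset n
        S′ = setOf S′?

        ∈S′⁺ : ∀ {s} → s ∈ S → s ⊖ c ∈ S′
        ∈S′⁺ {s} s∈S = ∈setOf⁺ S′? (subst (_∈ S) (sym ([x-y]+y≡x s c)) s∈S)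

        S′⊆H : S′ ⊆ H
        S′⊆H {z} z∈S′ = subst (_∈ H) ([x+y]-y≡x z c) (S⊆c⊕H (∈setOf⁻ S′? z∈S′))

        ∣S∣≤∣S′∣ : ∣ S ∣ ≤ ∣ S′ ∣
        ∣S∣≤∣S′∣ = π[p]⊆q⇒∣p∣≤∣q∣ (translation (⊖ c)) ∈S′⁺

      module I = Isoperimetry H-subgroup S′⊆H (∈S′⁺ s₀∈S)

      c∉H : c ∉ H
      c∉H c∈H = [ g∉H , (λ g⊖c∈H → g∉H (subst (_∈ H) ([x-y]+y≡x g c) (⊕-closed g⊖c∈H c∈H))) ]
                (coset-cover H-subgroup S⊆c⊕H g)

      -- odd Z is Z ∩ (H ⊕ c) translated back into H.
      even odd : Subset n → Subset n
      even Z = setOf (λ z → z ∈? H ×-dec z ∈? Z)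
      odd  Z = setOf (λ z → z ∈? H ×-dec (z ⊕ c) ∈? Z)

      ∈even⁺ : ∀ {Z z} → z ∈ H → z ∈ Z → z ∈ even Z
      ∈even⁺ {Z} z∈H z∈Z = ∈setOf⁺ (λ z → z ∈? H ×-dec z ∈? Z) (z∈H , z∈Z)

      ∈even⁻ : ∀ {Z z} → z ∈ even Z → z ∈ H × z ∈ Z
      ∈even⁻ {Z} = ∈setOf⁻ (λ z → z ∈? H ×-dec z ∈? Z)

      ∈odd⁺ : ∀ {Z z} → z ∈ H → z ⊕ c ∈ Z → z ∈ odd Z
      ∈odd⁺ {Z} z∈H z⊕c∈Z = ∈setOf⁺ (λ z → z ∈? H ×-dec (z ⊕ c) ∈? Z) (z∈H , z⊕c∈Z)

      ∈odd⁻ : ∀ {Z z} → z ∈ odd Z → z ∈ H × z ⊕ c ∈ Z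
      ∈odd⁻ {Z} = ∈setOf⁻ (λ z → z ∈? H ×-dec (z ⊕ c) ∈? Z)

      ∣even∣+∣odd∣≤∣T∣ : ∀ T → ∣ even T ∣ + ∣ odd T ∣ ≤ ∣ T ∣
      ∣even∣+∣odd∣≤∣T∣ T = begin
        ∣ even T ∣ + ∣ odd T ∣          ≤⟨ +-monoʳ-≤ (∣ even T ∣) (π[p]⊆q⇒∣p∣≤∣q∣ (translation c) odd⊕c⊆T∩[H⊕c]) ⟩
        ∣ even T ∣ + ∣ T∩[H⊕c] ∣        ≤⟨ disjoint⇒∣p∣+∣q∣≤∣r∣ disjoint (proj₂ ∘ ∈even⁻) (proj₂ ∘ ∈setOf⁻ T∩[H⊕c]?) ⟩
        ∣ T ∣                            ∎
        where
        open ≤-Reasoning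
        T∩[H⊕c]? : Decidable (λ z → z ⊖ c ∈ H × z ∈ T)
        T∩[H⊕c]? z = (z ⊖ c) ∈? H ×-dec z ∈? T
        T∩[H⊕c] = setOf T∩[H⊕c]?
        odd⊕c⊆T∩[H⊕c] : ∀ {z} → z ∈ odd T → z ⊕ c ∈ T∩[H⊕c]
        odd⊕c⊆T∩[H⊕c] {z} z∈odd = let z∈H , z⊕c∈T = ∈odd⁻ z∈odd in
          ∈setOf⁺ T∩[H⊕c]? (subst (_∈ H) (sym ([x+y]-y≡x z c)) z∈H , z⊕c∈T)
        disjoint : ∀ {z} → z ∈ even T → z ∉ T∩[H⊕c]
        disjoint {z} z∈even z∈T∩[H⊕c] =
          c∉H (subst (_∈ H) (x-[x-y]≡y z c) (⊖-closed (proj₁ (∈even⁻ z∈even)) (proj₁ (∈setOf⁻ T∩[H⊕c]? z∈T∩[H⊕c]))))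

      ∣S∣≤∣P∣ : ∀ {A a P} → a ∈ A → I.N A ⊆ P → ∣ S ∣ ≤ ∣ P ∣
      ∣S∣≤∣P∣ a∈A NA⊆P = ≤-trans ∣S∣≤∣S′∣ (≤-trans (I.∣S∣≤∣NA∣ a∈A) (p⊆q⇒∣p∣≤∣q∣ NA⊆P))

      module _ {T Z} (Z-closed : Closed S T Z) where

        N[even]⊆odd∪odd : I.N (even Z) ⊆ odd Z ∪ odd T
        N[even]⊆odd∪odd {z} z∈N = x∈p∪q⁺ (Sum.map (∈odd⁺ z∈H) (∈odd⁺ z∈H) (closed-step Z-closed a∈Z a~z⊕c))
          where
          z∈H = I.N⊆K (proj₁ ∘ ∈even⁻) z∈N
          a = proj₁ (I.∈N⁻ z∈N)
          a∈Z = proj₂ (∈even⁻ (proj₁ (proj₂ (I.∈N⁻ z∈N))))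
          a~z⊕c : CayAdj G S a (z ⊕ c)
          a~z⊕c = subst (_∈ S) (assoc a z c) (∈setOf⁻ S′? (proj₂ (proj₂ (I.∈N⁻ z∈N))))

        N[odd]⊆even∪even : I.N (odd Z) ⊆ even Z ∪ even T
        N[odd]⊆even∪even {z} z∈N = x∈p∪q⁺ (Sum.map (∈even⁺ z∈H) (∈even⁺ z∈H) (closed-step Z-closed a⊕c∈Z a⊕c~z))
          where
          z∈H = I.N⊆K (proj₁ ∘ ∈odd⁻) z∈N
          a = proj₁ (I.∈N⁻ z∈N)
          a⊕c∈Z = proj₂ (∈odd⁻ (proj₁ (proj₂ (I.∈N⁻ z∈N))))
          a⊕c~z : CayAdj G S (a ⊕ c) z
          a⊕c~z = subst (_∈ S) ([x+y]+z≡[x+z]+y a z c) (∈setOf⁻ S′? (proj₂ (proj₂ (I.∈N⁻ z∈N))))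

        even-fragment : Nonempty (even Z) → ∀ {q} → q ∈ H → q ⊕ c ∉ Z → q ⊕ c ∉ T → I.Fragment (even Z)
        even-fragment even≢∅ q∈H q⊕c∉Z q⊕c∉T = record
          { ⊆K       = proj₁ ∘ ∈even⁻
          ; nonempty = even≢∅
          ; missing  = _ , q∈H , λ q∈N →
              [ q⊕c∉Z ∘ proj₂ ∘ ∈odd⁻ , q⊕c∉T ∘ proj₂ ∘ ∈odd⁻ ] (x∈p∪q⁻ _ _ (N[even]⊆odd∪odd q∈N))
          }

        odd-fragment : Nonempty (odd Z) → ∀ {p} → p ∈ H → p ∉ Z → p ∉ T → I.Fragment (odd Z)
        odd-fragment odd≢∅ p∈H p∉Z p∉T = record
          { ⊆K       = proj₁ ∘ ∈odd⁻
          ; nonempty = odd≢∅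
          ; missing  = _ , p∈H , λ p∈N →
              [ p∉Z ∘ proj₂ ∘ ∈even⁻ , p∉T ∘ proj₂ ∘ ∈even⁻ ] (x∈p∪q⁻ _ _ (N[odd]⊆even∪even p∈N))
          }

        parts-or-bound : ∀ {w} → w ∈ Z → ∣ S ∣ ≤ ∣ T ∣ ⊎ Nonempty (even Z) × Nonempty (odd Z)
        parts-or-bound {w} w∈Z with coset-cover H-subgroup S⊆c⊕H w
        ... | inj₁ w∈H with nonempty? (odd Z)
        ...   | yes odd≢∅ = inj₂ ((w , ∈even⁺ w∈H w∈Z) , odd≢∅)
        ...   | no  odd≡∅ = inj₁ (≤-trans (∣S∣≤∣P∣ (∈even⁺ w∈H w∈Z)
                  (λ z∈N → [ (λ z∈odd → ⊥-elim (odd≡∅ (_ , z∈odd))) , id ] (x∈p∪q⁻ _ _ (N[even]⊆odd∪odd z∈N))))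
                  (≤-trans (m≤n+m _ _) (∣even∣+∣odd∣≤∣T∣ T)))
        parts-or-bound {w} w∈Z | inj₂ w⊖c∈H with nonempty? (even Z)
        ...   | yes even≢∅ = inj₂ (even≢∅ , (w ⊖ c , ∈odd⁺ w⊖c∈H (subst (_∈ Z) (sym ([x-y]+y≡x w c)) w∈Z)))
        ...   | no  even≡∅ = inj₁ (≤-trans (∣S∣≤∣P∣ (∈odd⁺ w⊖c∈H (subst (_∈ Z) (sym ([x-y]+y≡x w c)) w∈Z))
                  (λ z∈N → [ (λ z∈even → ⊥-elim (even≡∅ (_ , z∈even))) , id ] (x∈p∪q⁻ _ _ (N[odd]⊆even∪even z∈N))))
                  (≤-trans (m≤m+n _ _) (∣even∣+∣odd∣≤∣T∣ T)))

      no-nested-obstruction : ¬ I.CosetObstruction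
      no-nested-obstruction obstruction = <⇒≱ (x∈p⇒∣p∣>0 𝟎∈) (+-cancelˡ-≤ (∣ H ∣) (∣ H ∣) 0 (begin
        ∣ H ∣ + ∣ H ∣   ≡⟨ cong (∣ H ∣ +_) (+-identityʳ (∣ H ∣)) ⟨
        2 * ∣ H ∣       ≤⟨ proper⇒2∣H∣≤∣K∣ H-subgroup ⊤-isSubgroup (λ _ → ∈⊤) ∈⊤ g∉H ⟩
        ∣ ⊤ {n = n} ∣   ≡⟨ ∣⊤∣≡n n ⟩
        n               ≤⟨ n≤2∣H∣ H₂-subgroup S⊆[c⊕c₂]⊕H₂ ⟩
        2 * ∣ H₂ ∣      ≤⟨ proper⇒2∣H∣≤∣K∣ H₂-subgroup H-subgroup H₂⊆K g₂∈K g₂∉H₂ ⟩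
        ∣ H ∣           ≡⟨ +-identityʳ (∣ H ∣) ⟨
        ∣ H ∣ + 0       ∎))
        where
        open ≤-Reasoning
        open I.CosetObstruction obstruction
          renaming (H to H₂; H-subgroup to H₂-subgroup; H⊆K to H₂⊆K; g to g₂; g∈K to g₂∈K; g∉H to g₂∉H₂;
                    c to c₂; S⊆c⊕H to S′⊆c₂⊕H₂)
        S⊆[c⊕c₂]⊕H₂ : ∀ {s} → s ∈ S → s ⊖ (c ⊕ c₂) ∈ H₂
        S⊆[c⊕c₂]⊕H₂ {s} s∈S = subst (_∈ H₂) ([x-y]-z≡x-[y+z] s c c₂) (S′⊆c₂⊕H₂ (∈S′⁺ s∈S))

      module _ {T X u v} (X-closed : Closed S T X) (u∈X : u ∈ X) (v∉X : v ∉ X) (v∉T : v ∉ T) where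

        private
          Y? : Decidable (λ w → w ∉ T × w ∉ X)
          Y? w = ¬? (w ∈? T) ×-dec ¬? (w ∈? X)

          Y : Subset n
          Y = setOf Y?

          Y-closed : Closed S T Y
          Y-closed {y} {w} y∈Y w∉T y~w = ∈setOf⁺ Y? (w∉T , λ w∈X →
            let y∉T , y∉X = ∈setOf⁻ Y? y∈Y in y∉X (X-closed w∈X y∉T (subst (_∈ S) (comm y w) y~w)))

          two-sided : ∀ {s e₀ e₁ x₀ x₁ t₀ t₁} → s ≤ 2 * e₀ → s ≤ 2 * e₁ →
                      e₀ + x₀ ≤ x₁ + t₁ → e₁ + x₁ ≤ x₀ + t₀ → s ≤ t₀ + t₁
          two-sided {s} {e₀} {e₁} {x₀} {x₁} {t₀} {t₁} s≤2e₀ s≤2e₁ e₀+x₀≤ e₁+x₁≤ = *-cancelˡ-≤ 2 (begin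
            2 * s              ≡⟨ cong (s +_) (+-identityʳ s) ⟩
            s + s              ≤⟨ +-mono-≤ s≤2e₀ s≤2e₁ ⟩
            2 * e₀ + 2 * e₁    ≡⟨ *-distribˡ-+ 2 e₀ e₁ ⟨
            2 * (e₀ + e₁)      ≤⟨ *-monoʳ-≤ 2 e₀+e₁≤t₀+t₁ ⟩
            2 * (t₀ + t₁)      ∎)
            where
            open ≤-Reasoning
            rearrange : ∀ x₀ x₁ t₀ t₁ → x₁ + t₁ + (x₀ + t₀) ≡ t₀ + t₁ + (x₀ + x₁)
            rearrange = solve-∀
            e₀+e₁≤t₀+t₁ : e₀ + e₁ ≤ t₀ + t₁
            e₀+e₁≤t₀+t₁ = +-cancelʳ-≤ (x₀ + x₁) (e₀ + e₁) (t₀ + t₁) (begin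
              e₀ + e₁ + (x₀ + x₁)      ≡⟨ +-interchange e₀ e₁ x₀ x₁ ⟩
              e₀ + x₀ + (e₁ + x₁)      ≤⟨ +-mono-≤ e₀+x₀≤ e₁+x₁≤ ⟩
              x₁ + t₁ + (x₀ + t₀)      ≡⟨ rearrange x₀ x₁ t₀ t₁ ⟩
              t₀ + t₁ + (x₀ + x₁)      ∎)

        bipartite-bound : ∣ S ∣ ≤ ∣ T ∣
        bipartite-bound with parts-or-bound X-closed u∈X | parts-or-bound Y-closed (∈setOf⁺ Y? (v∉T , v∉X))
        ... | inj₁ bound | _          = bound
        ... | inj₂ _     | inj₁ bound = bound
        ... | inj₂ (even-X≢∅ , odd-X≢∅) | inj₂ ((p , p∈even-Y) , (q , q∈odd-Y)) with I.isoperimetric-or-coset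
        ...   | inj₂ obstruction = ⊥-elim (no-nested-obstruction obstruction)
        ...   | inj₁ isoperimetric = begin
          ∣ S ∣                        ≤⟨ ∣S∣≤∣S′∣ ⟩
          ∣ S′ ∣                       ≤⟨ two-sided {e₀ = I.excess (even X)} {I.excess (odd X)}
                                                    {∣ even X ∣} {∣ odd X ∣} {∣ even T ∣} {∣ odd T ∣}
                                                    (isoperimetric even-X-fragment) (isoperimetric odd-X-fragment)
                                                    (excess+size≤ (even X) (N[even]⊆odd∪odd X-closed))
                                                    (excess+size≤ (odd X) (N[odd]⊆even∪even X-closed)) ⟩
          ∣ even T ∣ + ∣ odd T ∣      ≤⟨ ∣even∣+∣odd∣≤∣T∣ T ⟩
          ∣ T ∣                        ∎
          where
          open ≤-Reasoning
          p∈H×Y = ∈even⁻ p∈even-Y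
          q∈H×Y = ∈odd⁻ q∈odd-Y
          even-X-fragment = even-fragment X-closed even-X≢∅ (proj₁ q∈H×Y)
            (proj₂ (∈setOf⁻ Y? (proj₂ q∈H×Y))) (proj₁ (∈setOf⁻ Y? (proj₂ q∈H×Y)))
          odd-X-fragment = odd-fragment X-closed odd-X≢∅ (proj₁ p∈H×Y)
            (proj₂ (∈setOf⁻ Y? (proj₂ p∈H×Y))) (proj₁ (∈setOf⁻ Y? (proj₂ p∈H×Y)))
          excess+size≤ : ∀ A {P Q} → I.N A ⊆ P ∪ Q → I.excess A + ∣ A ∣ ≤ ∣ P ∣ + ∣ Q ∣
          excess+size≤ A NA⊆P∪Q = ≤-trans (≤-reflexive (I.excess+∣A∣≡∣NA∣ A)) (r⊆p∪q⇒∣r∣≤∣p∣+∣q∣ NA⊆P∪Q)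

    module _ {s₀ T X u v} (s₀∈S : s₀ ∈ S) (X-closed : Closed S T X) (u∈X : u ∈ X) (v∉X : v ∉ X) (v∉T : v ∉ T) where

      open Isoperimetry ⊤-isSubgroup (λ _ → ∈⊤) s₀∈S

      private
        NX⊆X∪T : N X ⊆ X ∪ T
        NX⊆X∪T z∈NX = let _ , a∈X , a~z = ∈N⁻ z∈NX in x∈p∪q⁺ (closed-step X-closed a∈X a~z)

        X-fragment : Fragment X
        X-fragment = record
          { ⊆K       = λ _ → ∈⊤
          ; nonempty = u , u∈X
          ; missing  = v , ∈⊤ , λ v∈NX → [ v∉X , v∉T ] (x∈p∪q⁻ X T (NX⊆X∪T v∈NX))
          }

        excess≤∣T∣ : excess X ≤ ∣ T ∣
        excess≤∣T∣ = +-cancelʳ-≤ (∣ X ∣) (excess X) (∣ T ∣) (begin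
          excess X + ∣ X ∣  ≡⟨ excess+∣A∣≡∣NA∣ X ⟩
          ∣ N X ∣           ≤⟨ r⊆p∪q⇒∣r∣≤∣p∣+∣q∣ NX⊆X∪T ⟩
          ∣ X ∣ + ∣ T ∣     ≡⟨ +-comm (∣ X ∣) (∣ T ∣) ⟩
          ∣ T ∣ + ∣ X ∣     ∎)
          where open ≤-Reasoning

      closed-set-bound : ∣ S ∣ ≤ 2 * ∣ T ∣
      closed-set-bound with isoperimetric-or-coset
      ... | inj₁ isoperimetric = ≤-trans (isoperimetric X-fragment) (*-monoʳ-≤ 2 excess≤∣T∣)
      ... | inj₂ obstruction   = ≤-trans (Bipartite.bipartite-bound s₀∈S H-subgroup g∉H S⊆c⊕H X-closed u∈X v∉X v∉T)
                                         (m≤m+n (∣ T ∣) (∣ T ∣ + 0))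
        where open CosetObstruction obstruction

  single-vertex-bound : ∀ {S T : Subset n} {g} → g ∉ S → ∣ ∁ T ∣ ≡ 1 → ∣ S ∣ ≤ ∣ T ∣
  single-vertex-bound {S} {T} g∉S ∣∁T∣≡1 = ≤-pred (begin
    suc ∣ S ∣            ≤⟨ p⊂q⇒∣p∣<∣q∣ {q = ⊤} ((λ _ → ∈⊤) , _ , ∈⊤ , g∉S) ⟩
    ∣ ⊤ {n = n} ∣        ≡⟨ ∣⊤∣≡n n ⟩
    n                    ≤⟨ m≤n+m∸n n (∣ T ∣) ⟩
    ∣ T ∣ + (n ∸ ∣ T ∣)  ≡⟨ cong (∣ T ∣ +_) (trans (sym (∣∁p∣≡n∸∣p∣ T)) ∣∁T∣≡1) ⟩
    ∣ T ∣ + 1            ≡⟨ +-comm (∣ T ∣) 1 ⟩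
    suc ∣ T ∣            ∎)
    where open ≤-Reasoning

  -- Reachability in ∁ T is only decided under a double negation, which is harmless as the goal is decidable.
  disconnected-bound : ∀ {S T : Subset n} → CayConnected G S → ¬ InducedConnected G S (∁ T) → ∣ S ∣ ≤ 2 * ∣ T ∣
  disconnected-bound {S} {T} connected ¬∁T-connected with ∣ S ∣ ≤? 2 * ∣ T ∣ | nonempty? S
  ... | yes bound | _                = bound
  ... | no  ¬bound | no  S≡∅         = ⊥-elim (¬bound (subst (_≤ 2 * ∣ T ∣) (sym ∣S∣≡0) z≤n))
    where ∣S∣≡0 = trans (cong ∣_∣ (Empty-unique S≡∅)) (∣⊥∣≡0 n)
  ... | no  ¬bound | yes (_ , s₀∈S)  = ⊥-elim (¬¬-∀ (λ _ → ¬¬-∀ λ _ → ¬¬-excluded-middle) λ reach? →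
    ¬∁T-connected λ u v u∈∁T v∈∁T → decidable-stable (reach? u v) λ u↛v →
      ¬bound (Connected.closed-set-bound connected s₀∈S (component-closed (reach? u))
               (∈setOf⁺ (reach? u) (here u∈∁T)) (u↛v ∘ ∈setOf⁻ (reach? u)) (x∈∁p⇒x∉p v∈∁T)))
    where
    component-closed : ∀ {u} (reach? : Decidable (Reach G S (∁ T) u)) →
                       Closed S T (setOf reach?)
    component-closed reach? x∈X w∉T x~w =
      ∈setOf⁺ reach? (step (∈setOf⁻ reach? x∈X) (x∉p⇒x∈∁p w∉T) x~w)

  separator-bound : ∀ {S T : Subset n} {g} → g ∉ S → CayConnected G S → Separating G S T → ∣ S ∣ ≤ 2 * ∣ T ∣
  separator-bound g∉S connected (inj₁ ¬∁T-connected) = disconnected-bound connected ¬∁T-connected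
  separator-bound {T = T} g∉S connected (inj₂ ∣∁T∣≡1) =
    ≤-trans (single-vertex-bound {T = T} g∉S ∣∁T∣≡1) (m≤m+n (∣ T ∣) (∣ T ∣ + 0))

corollary4 : (G : FiniteAbelianGroup) → (S : Subset (FiniteAbelianGroup.n G))
    → ∃ (λ g → g ∉ S)
    → CayConnected G S
    → (k : ℕ) → IsConnectivity G S k
    → ∣ S ∣ ≤ 2 * k
corollary4 G S (_ , g∉S) connected k ((T , T-separating , ∣T∣≡k) , _) =
  subst (λ k → ∣ S ∣ ≤ 2 * k) ∣T∣≡k (separator-bound G g∉S connected T-separating)
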